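{- For integers $r,t\ge 2$ there is a constant $C = C(r,t)$ such that, for $n$ sufficiently large, every $2$-edge-coloring of $K_n$ with at least $C$ edges in each color class and without a monochromatic induced $rK_2$ contains an induced monochromatic $K_{1,t}$.
   Context: A $2$-edge-coloring of $K_n$ is a partition $E(K_n)=E(R)\cup E(B)$ into red and blue edges. The coloring contains an induced monochromatic copy of a graph $H$ if there is $U\subseteq V(K_n)$ with $|U|=|V(H)|$ such that the red edges inside $U$, or the blue edges inside $U$, form a graph isomorphic to $H$. $rK_2$ is a matching with $r$ edges; $K_{1,t}$ is the star with $t$ leaves. -}

module Defs where

open import Data.Nat using (ℕ; zero; suc; _+_; _*_; _<_; _≤_; _<ᵇ_; _≡ᵇ_)
open import Data.Nat.DivMod using (_/_)
open import Data.Bool using (Bool; true; false; _∧_; _xor_; not; if_then_else_)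
open import Data.Fin using (Fin; toℕ; _≟_)
open import Data.List using (List; length; filter; cartesianProduct; allFin)
open import Data.Product using (Σ; ∃; _×_; _,_; proj₁; proj₂)
open import Relation.Binary.PropositionalEquality using (_≡_; _≢_)
open import Data.Sum using (_⊎_)
open import Function.Definitions using (Injective)
open import Function.Bundles using (_⇔_)
open import Data.Bool.Properties renaming (_≟_ to _≟B_)

-- A 2-edge-colouring of K_n: a symmetric function assigning to each pair of
-- vertices a colour (true = red, false = blue). Diagonal values are ignored.
record Colouring (n : ℕ) : Set where
  field
    col : Fin n → Fin n → Bool
    sym : ∀ i j → col i j ≡ col j i
open Colouring public

-- A (simple) graph on vertex set Fin k, given by a Boolean adjacency relation
-- (only values on distinct pairs matter).
Graph : ℕ → Set
Graph k = Fin k → Fin k → Bool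

edgeCount : ∀ {n} → Colouring n → Bool → ℕ
edgeCount {n} χ c =
  length (filter (λ p → Data.Bool.Properties._≟_ (col χ (proj₁ p) (proj₂ p)) c)
                 (filter (λ p → Data.Nat._<?_ (toℕ (proj₁ p)) (toℕ (proj₂ p)))
                         (cartesianProduct (allFin n) (allFin n))))

InducedCopy : ∀ {n k} → Colouring n → Bool → Graph k → Set
InducedCopy {n} {k} χ c H =
  Σ (Fin k → Fin n) λ f → Injective _≡_ _≡_ f ×
    (∀ a b → a ≢ b → col χ (f a) (f b) ≡ c ⇔ H a b ≡ true)

HasInducedMono : ∀ {n k} → Colouring n → Graph k → Set
HasInducedMono χ H = Σ Bool λ c → InducedCopy χ c H

-- r K_2 on Fin (2r): vertices 2i and 2i+1 adjacent, nothing else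
matching : (r : ℕ) → Graph (2 * r)
matching r a b = toℕ a / 2 ≡ᵇ toℕ b / 2

-- K_{1,t} on Fin (1+t): centre 0 adjacent to every other vertex
star : (t : ℕ) → Graph (suc t)
star t a b = (toℕ a ≡ᵇ 0) xor (toℕ b ≡ᵇ 0)

-- Ramsey's theorem gives a clique K of size t² + 1 in one colour, say ¬c.
-- If some vertex v has c-degree at least R(t,t), Ramsey inside its c-neighbourhood
-- yields either t c-neighbours spanning a ¬c-clique (an induced c-star at v) or a
-- c-clique X of size t.  Then either some x ∈ X has t c-neighbours in K (a c-star
-- at x), or each x ∈ X is equal or c-adjacent to fewer than t vertices of K, so
-- some y ∈ K is ¬c-adjacent to all of X (a ¬c-star at y).  Otherwise every
-- c-degree is below D = R(t,t), so the C c-edges touch more than r·2(D+1)²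
-- vertices; as a c-edge lies within distance two of at most 2(D+1)² vertices,
-- r c-edges with only ¬c-edges between their endpoints can be chosen greedily,
-- giving an induced c-coloured rK₂.
module Submission where

open import Defs hiding (sym)
open import Level using (0ℓ)
open import Function using (_∘_; id; _⇔_; mk⇔; Equivalence)
open import Function.Definitions using (Injective)
open import Data.Nat using (ℕ; zero; suc; _+_; _*_; _≤_; _<_; z≤n; s≤s; _≤?_; _<?_)
open import Data.Nat.Properties
open import Data.Nat.DivMod using (_/_; _%_; _mod_; m≡m%n+[m/n]*n; m<n*o⇒m/o<n)
open import Data.Bool using (Bool; true; false; not)
open import Data.Bool.Properties using (not-¬; ¬-not; T-≡) renaming (_≟_ to _≟ᵇ_)
open import Data.Fin using (Fin; zero; suc; toℕ; fromℕ<) renaming (_≟_ to _≟ᶠ_)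
open import Data.Fin.Properties using (toℕ-injective; toℕ-fromℕ<; toℕ<n; ¬∀⟶∃¬) renaming (all? to allFin?)
open import Data.List using (List; []; _∷_; length; filter; map; _++_; lookup; allFin; cartesianProduct)
open import Data.List.Properties using (filter-all; filter-none; filter-accept; filter-++; length-++; length-take; length-tabulate)
open import Data.List.Relation.Unary.Any using (Any; here; there; any?; satisfied)
open import Data.List.Relation.Unary.All as All using (All; []; _∷_; all?)
open import Data.List.Relation.Unary.All.Properties using (all-filter; take⁺)
open import Data.List.Relation.Unary.All.Properties.Core using (¬Any⇒All¬; ¬All⇒Any¬)
open import Data.List.Relation.Unary.AllPairs as AllPairs using (AllPairs; []; _∷_)
open import Data.List.Relation.Unary.AllPairs.Properties as AllPairsₚ using ()
open import Data.List.Relation.Unary.Unique.Propositional using (Unique)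
open import Data.List.Relation.Unary.Unique.Propositional.Properties using (allFin⁺)
open import Data.List.Membership.Propositional using (_∈_; lose)
open import Data.List.Membership.Propositional.Properties using (∈-filter⁻; ∈-filter⁺; ∈-allFin; ∈-lookup)
open import Data.List.Relation.Binary.Subset.Propositional using (_⊆_)
open import Data.List.Relation.Binary.Subset.Propositional.Properties using (filter-⊆; xs⊆x∷xs; ∷⁺ʳ)
open import Data.Product using (Σ; ∃; _×_; _,_; proj₁; proj₂; uncurry)
open import Data.Sum as Sum using (_⊎_; inj₁; inj₂)
open import Relation.Nullary using (¬_; yes; no; does; ¬?; contradiction)
open import Relation.Nullary.Decidable using (_×-dec_; _⊎-dec_)
open import Relation.Unary using (Pred; Decidable; ∁; _∩_)
open import Relation.Unary.Properties using (∁?)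
open import Relation.Binary using (Rel; Symmetric; DecidableEquality)
open import Relation.Binary.PropositionalEquality
  using (_≡_; _≢_; refl; sym; trans; cong; cong₂; subst; ≢-sym; module ≡-Reasoning)

count : ∀ {A : Set} {P : Pred A 0ℓ} → Decidable P → List A → ℕ
count P? xs = length (filter P? xs)

module _ {A : Set} where

  module _ {P : Pred A 0ℓ} (P? : Decidable P) where

    count-∷-≤ : ∀ x xs → count P? xs ≤ count P? (x ∷ xs)
    count-∷-≤ x xs with does (P? x)
    ... | true  = n≤1+n _
    ... | false = ≤-refl

    count-accept : ∀ {x xs} → P x → count P? (x ∷ xs) ≡ suc (count P? xs)
    count-accept px = cong length (filter-accept P? px)

    count-++ : ∀ xs ys → count P? (xs ++ ys) ≡ count P? xs + count P? ys
    count-++ xs ys = trans (cong length (filter-++ P? xs ys)) (length-++ (filter P? xs))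

    count-map : ∀ {B : Set} (f : B → A) xs → count P? (map f xs) ≡ count (λ x → P? (f x)) xs
    count-map f []       = refl
    count-map f (x ∷ xs) with does (P? (f x))
    ... | true  = cong suc (count-map f xs)
    ... | false = count-map f xs

    count+count-∁ : ∀ xs → count P? xs + count (∁? P?) xs ≡ length xs
    count+count-∁ []       = refl
    count+count-∁ (x ∷ xs) with does (P? x)
    ... | true  = cong suc (count+count-∁ xs)
    ... | false = trans (+-suc _ _) (cong suc (count+count-∁ xs))

    count<length⇒Any∁ : ∀ xs → count P? xs < length xs → Any (∁ P) xs
    count<length⇒Any∁ xs lt with all? P? xs
    ... | yes all = contradiction (cong length (filter-all P? all)) (<⇒≢ lt)
    ... | no ¬all = ¬All⇒Any¬ P? xs ¬all

  module _ {P Q : Pred A 0ℓ} (P? : Decidable P) (Q? : Decidable Q) where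

    count<count⇒Any : ∀ xs → count Q? xs < count P? xs → Any (P ∩ ∁ Q) xs
    count<count⇒Any (x ∷ xs) lt with P? x | Q? x
    ... | yes px | no ¬qx = here (px , ¬qx)
    ... | yes _  | yes _  = there (count<count⇒Any xs (≤-pred lt))
    ... | no _   | no _   = there (count<count⇒Any xs lt)
    ... | no _   | yes _  = there (count<count⇒Any xs (≤-trans (n≤1+n _) lt))

  module _ {P Q R : Pred A 0ℓ} (P? : Decidable P) (Q? : Decidable Q) (R? : Decidable R) where

    count-⊎ : (∀ {x} → P x → Q x ⊎ R x) → ∀ xs → count P? xs ≤ count Q? xs + count R? xs
    count-⊎ P⊆Q∪R []       = z≤n
    count-⊎ P⊆Q∪R (x ∷ xs) with ih ← count-⊎ P⊆Q∪R xs | P? x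
    ... | no _ = ≤-trans ih (+-mono-≤ (count-∷-≤ Q? x xs) (count-∷-≤ R? x xs))
    ... | yes px with P⊆Q∪R px
    ...   | inj₁ qx = ≤-trans (s≤s ih)
                        (+-mono-≤ (≤-reflexive (sym (count-accept Q? qx))) (count-∷-≤ R? x xs))
    ...   | inj₂ rx = ≤-trans (s≤s ih) (≤-trans (≤-reflexive (sym (+-suc _ _)))
                        (+-mono-≤ (count-∷-≤ Q? x xs) (≤-reflexive (sym (count-accept R? rx)))))

    count-∩ : (∀ {x} → P x → Q x → R x) → ∀ xs → count P? (filter Q? xs) ≤ count R? xs
    count-∩ P∩Q⊆R []       = z≤n
    count-∩ P∩Q⊆R (x ∷ xs) with ih ← count-∩ P∩Q⊆R xs | Q? x
    ... | no _ = ≤-trans ih (count-∷-≤ R? x xs)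
    ... | yes qx with P? x
    ...   | no _   = ≤-trans ih (count-∷-≤ R? x xs)
    ...   | yes px = ≤-trans (s≤s ih) (≤-reflexive (sym (count-accept R? (P∩Q⊆R px qx))))

  count-Any≤ : ∀ {B : Set} {Q : B → Pred A 0ℓ} (Q? : ∀ w → Decidable (Q w)) {M} xs ws →
    All (λ w → count (Q? w) xs ≤ M) ws → count (λ x → any? (λ w → Q? w x) ws) xs ≤ length ws * M
  count-Any≤ Q? xs []       []         =
    ≤-reflexive (cong length (filter-none (λ x → any? (λ w → Q? w x) []) {xs} (All.tabulate λ _ ())))
  count-Any≤ {Q = Q} Q? xs (w ∷ ws) (few ∷ fews) =
    ≤-trans (count-⊎ _ (Q? w) _ here-or-there xs) (+-mono-≤ few (count-Any≤ Q? xs ws fews))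
    where
    here-or-there : ∀ {x} → Any (λ w → Q w x) (w ∷ ws) → Q w x ⊎ Any (λ w → Q w x) ws
    here-or-there (here q)  = inj₁ q
    here-or-there (there q) = inj₂ q

  count-≟≤1 : (_≟_ : DecidableEquality A) → ∀ w {xs} → Unique xs → count (w ≟_) xs ≤ 1
  count-≟≤1 _≟_ w {[]}     []            = z≤n
  count-≟≤1 _≟_ w {x ∷ xs} (x∉xs ∷ xs!) with w ≟ x
  ... | no _     = count-≟≤1 _≟_ w xs!
  ... | yes refl = s≤s (≤-reflexive (cong length (filter-none (w ≟_) x∉xs)))

  AllPairs-lookup : ∀ {R : Rel A 0ℓ} → Symmetric R → ∀ {xs} → AllPairs R xs →
    ∀ {i j} → i ≢ j → R (lookup xs i) (lookup xs j)
  AllPairs-lookup R-sym (_  ∷ _)   {zero}  {zero}  i≢j = contradiction refl i≢j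
  AllPairs-lookup R-sym (px ∷ _)   {zero}  {suc j} _   = All.lookup px (∈-lookup j)
  AllPairs-lookup R-sym (px ∷ _)   {suc i} {zero}  _   = R-sym (All.lookup px (∈-lookup i))
  AllPairs-lookup R-sym (_  ∷ pxs) {suc i} {suc j} i≢j = AllPairs-lookup R-sym pxs (i≢j ∘ cong suc)

+-≤-split : ∀ {m n o p} → m + n ≤ o + p → m ≤ o ⊎ n ≤ p
+-≤-split {m} {n} {o} {p} le with m ≤? o
... | yes m≤o = inj₁ m≤o
... | no  m≰o = inj₂ (≮⇒≥ λ p<n → <⇒≱ (+-mono-< (≰⇒> m≰o) p<n) le)

ramseyBound : ℕ → ℕ → ℕ
ramseyBound zero    _       = 0
ramseyBound (suc _) zero    = 0
ramseyBound (suc a) (suc b) = suc (ramseyBound a (suc b) + ramseyBound (suc a) b)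

-- D = R(t,t) bounds the degrees in the low-degree case, and each greedily chosen
-- edge blocks at most 2(D+1)² vertices.
edgeThreshold : ℕ → ℕ → ℕ
edgeThreshold r t = let D = ramseyBound t t in suc D * suc (r * (suc D * suc D + suc D * suc D))

endpoint : ∀ {A : Set} → Fin 2 → A × A → A
endpoint zero    = proj₁
endpoint (suc _) = proj₂

-- Fin (2 * r) as r pairs {2i, 2i+1}: vertex a is endpoint side a of pair half a.
module Pairing (r : ℕ) where

  half : Fin (2 * r) → Fin r
  half a = fromℕ< (m<n*o⇒m/o<n (subst (toℕ a <_) (*-comm 2 r) (toℕ<n a)))

  side : Fin (2 * r) → Fin 2
  side a = toℕ a mod 2

  toℕ-half : ∀ a → toℕ (half a) ≡ toℕ a / 2
  toℕ-half a = toℕ-fromℕ< _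

  toℕ-side : ∀ a → toℕ (side a) ≡ toℕ a % 2
  toℕ-side a = toℕ-fromℕ< _

  side+half*2≡toℕ : ∀ a → toℕ (side a) + toℕ (half a) * 2 ≡ toℕ a
  side+half*2≡toℕ a = begin
    toℕ (side a) + toℕ (half a) * 2  ≡⟨ cong₂ (λ s h → s + h * 2) (toℕ-side a) (toℕ-half a) ⟩
    toℕ a % 2 + toℕ a / 2 * 2        ≡⟨ m≡m%n+[m/n]*n (toℕ a) 2 ⟨
    toℕ a                            ∎
    where open ≡-Reasoning

  half-side-injective : ∀ {a b} → half a ≡ half b → side a ≡ side b → a ≡ b
  half-side-injective {a} {b} ha≡hb sa≡sb = toℕ-injective (begin
    toℕ a                             ≡⟨ side+half*2≡toℕ a ⟨
    toℕ (side a) + toℕ (half a) * 2  ≡⟨ cong₂ (λ s h → toℕ s + toℕ h * 2) sa≡sb ha≡hb ⟩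
    toℕ (side b) + toℕ (half b) * 2  ≡⟨ side+half*2≡toℕ b ⟩
    toℕ b                             ∎)
    where open ≡-Reasoning

  matching≡true⇔same-half : ∀ a b → matching r a b ≡ true ⇔ half a ≡ half b
  matching≡true⇔same-half a b = mk⇔
    (λ m → toℕ-injective (trans (toℕ-half a)
             (trans (≡ᵇ⇒≡ _ _ (Equivalence.from T-≡ m)) (sym (toℕ-half b)))))
    (λ h → Equivalence.to T-≡ (≡⇒≡ᵇ _ _ (trans (sym (toℕ-half a))
             (trans (cong toℕ h) (toℕ-half b)))))

module _ {n : ℕ} (χ : Colouring n) where

  Adj : Bool → Fin n → Fin n → Set
  Adj c x y = x ≢ y × col χ x y ≡ c

  Adj? : ∀ c x → Decidable (Adj c x)
  Adj? c x y = ¬? (x ≟ᶠ y) ×-dec (col χ x y ≟ᵇ c)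

  Adj-sym : ∀ {c} → Symmetric (Adj c)
  Adj-sym (x≢y , xy≡c) = ≢-sym x≢y , trans (Colouring.sym χ _ _) xy≡c

  ¬Adj⇒Adj-not : ∀ {c x y} → x ≢ y → ¬ Adj c x y → Adj (not c) x y
  ¬Adj⇒Adj-not x≢y ¬xy = x≢y , ¬-not (λ xy≡c → ¬xy (x≢y , xy≡c))

  Clique : Bool → List (Fin n) → Set
  Clique c = AllPairs (Adj c)

  neighbours : Bool → Fin n → List (Fin n)
  neighbours c v = filter (Adj? c v) (allFin n)

  degree : Bool → Fin n → ℕ
  degree c v = length (neighbours c v)

  Near : Bool → Fin n → Fin n → Set
  Near c w y = w ≡ y ⊎ Adj c w y

  Near? : ∀ c w → Decidable (Near c w)
  Near? c w y = (w ≟ᶠ y) ⊎-dec (Adj? c w y)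

  ¬Near⇒Adj-not : ∀ {c w y} → ¬ Near c w y → Adj (not c) w y
  ¬Near⇒Adj-not ¬near = ¬Adj⇒Adj-not (¬near ∘ inj₁) (¬near ∘ inj₂)

  count-Near : ∀ {c w xs} → Unique xs → count (Near? c w) xs ≤ suc (count (Adj? c w) xs)
  count-Near {c} {w} {xs} xs! =
    ≤-trans (count-⊎ (Near? c w) (w ≟ᶠ_) (Adj? c w) id xs) (+-monoˡ-≤ _ (count-≟≤1 _≟ᶠ_ w xs!))

  induced-copy : ∀ {k c c'} {H : Graph k} → c ≢ c' → (f : Fin k → Fin n) →
    (∀ a b → a ≢ b → H a b ≡ true  → Adj c  (f a) (f b)) →
    (∀ a b → a ≢ b → H a b ≡ false → Adj c' (f a) (f b)) →
    InducedCopy χ c H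
  induced-copy {c = c} {H = H} c≢c' f edge non-edge = f , injective , preserves
    where
    separates : ∀ {a b} → a ≢ b → f a ≢ f b
    separates {a} {b} a≢b with H a b in eq
    ... | true  = proj₁ (edge a b a≢b eq)
    ... | false = proj₁ (non-edge a b a≢b eq)

    injective : Injective _≡_ _≡_ f
    injective {a} {b} fa≡fb with a ≟ᶠ b
    ... | yes a≡b = a≡b
    ... | no  a≢b = contradiction fa≡fb (separates a≢b)

    preserves : ∀ a b → a ≢ b → col χ (f a) (f b) ≡ c ⇔ H a b ≡ true
    preserves a b a≢b with H a b in eq
    ... | true  = mk⇔ (λ _ → refl) (λ _ → proj₂ (edge a b a≢b eq))
    ... | false = mk⇔ (λ fab≡c → contradiction (trans (sym fab≡c) (proj₂ (non-edge a b a≢b eq))) c≢c')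
                      (λ ())

  star-copy : ∀ {c c' v ys t} → length ys ≡ t → c ≢ c' → All (Adj c v) ys → Clique c' ys →
    InducedCopy χ c (star t)
  star-copy {c} {c'} {v} {ys} refl c≢c' v~ys ys-clique = induced-copy c≢c' f edge non-edge
    where
    f : Fin (suc (length ys)) → Fin n
    f zero    = v
    f (suc i) = lookup ys i

    edge : ∀ a b → a ≢ b → star (length ys) a b ≡ true → Adj c (f a) (f b)
    edge zero    zero    a≢b _  = contradiction refl a≢b
    edge zero    (suc j) _   _  = All.lookup v~ys (∈-lookup j)
    edge (suc i) zero    _   _  = Adj-sym (All.lookup v~ys (∈-lookup i))
    edge (suc i) (suc j) _   ()

    non-edge : ∀ a b → a ≢ b → star (length ys) a b ≡ false → Adj c' (f a) (f b)
    non-edge zero    zero    a≢b _ = contradiction refl a≢b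
    non-edge zero    (suc j) _   ()
    non-edge (suc i) zero    _   ()
    non-edge (suc i) (suc j) a≢b _ = AllPairs-lookup Adj-sym ys-clique (a≢b ∘ cong suc)

  Edge : Bool → Fin n × Fin n → Set
  Edge c e = Adj c (proj₁ e) (proj₂ e)

  Separated : Bool → Rel (Fin n × Fin n) 0ℓ
  Separated c e e' = ∀ i j → Adj (not c) (endpoint i e) (endpoint j e')

  record InducedMatching (c : Bool) (k : ℕ) : Set where
    field
      edges     : List (Fin n × Fin n)
      size      : length edges ≡ k
      are-edges : All (Edge c) edges
      separated : AllPairs (Separated c) edges

  endpoints-adj : ∀ {c e i j} → Edge c e → i ≢ j → Adj c (endpoint i e) (endpoint j e)
  endpoints-adj {i = zero}     {zero}     _  i≢j = contradiction refl i≢j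
  endpoints-adj {i = zero}     {suc zero} ce _   = ce
  endpoints-adj {i = suc zero} {zero}     ce _   = Adj-sym ce
  endpoints-adj {i = suc zero} {suc zero} _  i≢j = contradiction refl i≢j

  matching-copy : ∀ {c k} → InducedMatching c k → InducedCopy χ c (matching k)
  matching-copy {c} record { edges = es ; size = refl ; are-edges = es-edges ; separated = es-sep } =
    induced-copy (not-¬ refl) f edge non-edge
    where
    open Pairing (length es)

    f : Fin (2 * length es) → Fin n
    f a = endpoint (side a) (lookup es (half a))

    edge : ∀ a b → a ≢ b → matching (length es) a b ≡ true → Adj c (f a) (f b)
    edge a b a≢b m = subst (λ h → Adj c (endpoint (side a) (lookup es h)) (f b)) (sym same)
      (endpoints-adj (All.lookup es-edges (∈-lookup (half b))) (a≢b ∘ half-side-injective same))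
      where
      same : half a ≡ half b
      same = Equivalence.to (matching≡true⇔same-half a b) m

    non-edge : ∀ a b → a ≢ b → matching (length es) a b ≡ false → Adj (not c) (f a) (f b)
    non-edge a b _ m≡false = AllPairs-lookup (λ s i j → Adj-sym (s j i)) es-sep different (side a) (side b)
      where
      different : half a ≢ half b
      different same with () ← trans (sym (Equivalence.from (matching≡true⇔same-half a b) same)) m≡false

  record CliqueIn (c : Bool) (k : ℕ) (xs : List (Fin n)) : Set where
    constructor clique
    field
      members   : List (Fin n)
      members⊆  : members ⊆ xs
      has-size  : length members ≡ k
      is-clique : Clique c members

  CliqueIn-widen : ∀ {c k xs ys} → xs ⊆ ys → CliqueIn c k xs → CliqueIn c k ys
  CliqueIn-widen xs⊆ys (clique ms ms⊆ |ms| ms-clique) = clique ms (xs⊆ys ∘ ms⊆) |ms| ms-clique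

  CliqueIn-extend : ∀ {c k v xs} {P : Pred (Fin n) 0ℓ} (P? : Decidable P) →
    (∀ {y} → y ∈ xs → P y → Adj c v y) → CliqueIn c k (filter P? xs) → CliqueIn c (suc k) (v ∷ xs)
  CliqueIn-extend {xs = xs} P? P⇒adj (clique ms ms⊆ |ms| ms-clique) =
    clique (_ ∷ ms) (∷⁺ʳ _ (filter-⊆ P? xs ∘ ms⊆)) (cong suc |ms|)
           (All.tabulate (uncurry P⇒adj ∘ ∈-filter⁻ P? ∘ ms⊆) ∷ ms-clique)

  ramsey : ∀ c a b {xs} → Unique xs → ramseyBound a b ≤ length xs →
    CliqueIn c a xs ⊎ CliqueIn (not c) b xs
  ramsey c zero    b       _ _ = inj₁ (clique [] (λ ()) refl [])
  ramsey c (suc a) zero    _ _ = inj₂ (clique [] (λ ()) refl [])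
  ramsey c (suc a) (suc b) {v ∷ xs} (v∉xs ∷ xs!) (s≤s big)
    with +-≤-split (≤-trans big (≤-reflexive (sym (count+count-∁ (Adj? c v) xs))))
  ... | inj₁ many-c =
    Sum.map (CliqueIn-extend (Adj? c v) (λ _ → id)) (CliqueIn-widen (xs⊆x∷xs xs v ∘ filter-⊆ _ xs))
            (ramsey c a (suc b) (AllPairsₚ.filter⁺ (Adj? c v) xs!) many-c)
  ... | inj₂ many-¬c =
    Sum.map (CliqueIn-widen (xs⊆x∷xs xs v ∘ filter-⊆ _ xs)) (CliqueIn-extend (∁? (Adj? c v)) ¬adj⇒adj-not)
            (ramsey c (suc a) b (AllPairsₚ.filter⁺ (∁? (Adj? c v)) xs!) many-¬c)
    where
    ¬adj⇒adj-not : ∀ {y} → y ∈ xs → ¬ Adj c v y → Adj (not c) v y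
    ¬adj⇒adj-not y∈xs = ¬Adj⇒Adj-not (All.lookup v∉xs y∈xs)

  many-neighbours⇒star : ∀ {c c' t x K} → c ≢ c' → Clique c' K → t ≤ count (Adj? c x) K →
    HasInducedMono χ (star t)
  many-neighbours⇒star {c} {t = t} {x} {K} c≢c' K-clique many =
    c , star-copy (trans (length-take t _) (m≤n⇒m⊓n≡m many)) c≢c'
          (take⁺ t (all-filter (Adj? c x) K)) (AllPairsₚ.take⁺ t (AllPairsₚ.filter⁺ (Adj? c x) K-clique))

  common-non-neighbour : ∀ {c t K X} → Unique K → length X * t < length K →
    All (λ x → count (Adj? c x) K < t) X → ∃ λ y → All (Adj (not c) y) X
  common-non-neighbour {c} {t} {K} {X} K! big few =
    let y , far = satisfied (count<length⇒Any∁ close? K (≤-<-trans count-close big))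
    in y , All.map (Adj-sym ∘ ¬Near⇒Adj-not) (¬Any⇒All¬ X far)
    where
    close? : Decidable (λ y → Any (λ w → Near c w y) X)
    close? y = any? (λ w → Near? c w y) X

    count-close : count close? K ≤ length X * t
    count-close = count-Any≤ (Near? c) K X (All.map (≤-trans (count-Near K!)) few)

  cliques⇒star : ∀ {c t K X} → Clique (not c) K → t * t < length K → Clique c X → length X ≡ t →
    HasInducedMono χ (star t)
  cliques⇒star {c} {t} {K} {X} K-clique big X-clique |X|≡t
    with all? (λ x → count (Adj? c x) K <? t) X
  ... | no ¬few =
    let _ , many = satisfied (¬All⇒Any¬ (λ x → count (Adj? c x) K <? t) X ¬few)
    in many-neighbours⇒star (not-¬ refl) K-clique (≮⇒≥ many)
  ... | yes few =
    let _ , y~X = common-non-neighbour (AllPairs.map proj₁ K-clique)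
                    (subst (λ k → k * t < length K) (sym |X|≡t) big) few
    in not c , star-copy |X|≡t (≢-sym (not-¬ refl)) y~X X-clique

  high-degree⇒star : ∀ {c t K v} → Clique (not c) K → t * t < length K →
    ramseyBound t t ≤ degree c v → HasInducedMono χ (star t)
  high-degree⇒star {c} {t} {K} {v} K-clique big high
    with ramsey c t t (AllPairsₚ.filter⁺ (Adj? c v) (allFin⁺ n)) high
  ... | inj₁ (clique X _ |X|≡t X-clique) = cliques⇒star K-clique big X-clique |X|≡t
  ... | inj₂ (clique Y Y⊆ |Y|≡t Y-clique) =
    c , star-copy |Y|≡t (not-¬ refl) (All.tabulate (proj₂ ∘ ∈-filter⁻ (Adj? c v) {xs = allFin n} ∘ Y⊆)) Y-clique

  module _ (c : Bool) {D : ℕ} (low : ∀ v → degree c v ≤ D) where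

    HasNeighbour? : Decidable (λ p → Any (Adj c p) (allFin n))
    HasNeighbour? p = any? (Adj? c p) (allFin n)

    Edge? : Decidable (Edge c)
    Edge? e = Adj? c (proj₁ e) (proj₂ e)

    count-Edge-row : ∀ x xs → count Edge? (cartesianProduct (x ∷ xs) (allFin n))
                                ≡ degree c x + count Edge? (cartesianProduct xs (allFin n))
    count-Edge-row x xs = trans (count-++ Edge? (map (x ,_) (allFin n)) _)
                                (cong (_+ _) (count-map Edge? (x ,_) (allFin n)))

    count-Edge : ∀ xs → count Edge? (cartesianProduct xs (allFin n)) ≤ suc D * count HasNeighbour? xs
    count-Edge []       = z≤n
    count-Edge (x ∷ xs) with HasNeighbour? x
    ... | yes _ = begin
      count Edge? (cartesianProduct (x ∷ xs) (allFin n))   ≡⟨ count-Edge-row x xs ⟩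
      degree c x + count Edge? (cartesianProduct xs (allFin n))
                                                           ≤⟨ +-mono-≤ (m≤n⇒m≤1+n (low x)) (count-Edge xs) ⟩
      suc D + suc D * count HasNeighbour? xs               ≡⟨ *-suc (suc D) _ ⟨
      suc D * suc (count HasNeighbour? xs)                 ∎
      where open ≤-Reasoning
    ... | no none = begin
      count Edge? (cartesianProduct (x ∷ xs) (allFin n))   ≡⟨ count-Edge-row x xs ⟩
      degree c x + count Edge? (cartesianProduct xs (allFin n))
                     ≡⟨ cong (_+ _) (cong length (filter-none (Adj? c x) (¬Any⇒All¬ _ none))) ⟩
      count Edge? (cartesianProduct xs (allFin n))         ≤⟨ count-Edge xs ⟩
      suc D * count HasNeighbour? xs                       ∎
      where open ≤-Reasoning

    edgeCount≤ : edgeCount χ c ≤ suc D * count HasNeighbour? (allFin n)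
    edgeCount≤ = ≤-trans (count-∩ (λ e → col χ (proj₁ e) (proj₂ e) ≟ᵇ c) (λ e → toℕ (proj₁ e) <? toℕ (proj₂ e))
                                  Edge? (λ xy≡c x<y → (λ x≡y → <-irrefl (cong toℕ x≡y) x<y) , xy≡c)
                                  (cartesianProduct (allFin n) (allFin n)))
                         (count-Edge (allFin n))

    Within2 : Fin n → Fin n → Set
    Within2 e p = Any (λ w → Near c w p) (e ∷ neighbours c e)

    Within2? : ∀ e → Decidable (Within2 e)
    Within2? e p = any? (λ w → Near? c w p) (e ∷ neighbours c e)

    count-Within2 : ∀ e → count (Within2? e) (allFin n) ≤ suc D * suc D
    count-Within2 e =
      ≤-trans (count-Any≤ (Near? c) (allFin n) (e ∷ neighbours c e) (All.tabulate λ {w} _ → near w))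
              (*-monoˡ-≤ (suc D) (s≤s (low e)))
      where
      near : ∀ w → count (Near? c w) (allFin n) ≤ suc D
      near w = ≤-trans (count-Near (allFin⁺ n)) (s≤s (low w))

    ¬Within2⇒Adj-not : ∀ {e p q} → ¬ Within2 e p → Adj c p q → ∀ i → Adj (not c) (endpoint i (p , q)) e
    ¬Within2⇒Adj-not ¬e≈p p~q zero       = Adj-sym (¬Near⇒Adj-not (¬e≈p ∘ here))
    ¬Within2⇒Adj-not {e} {p} {q} ¬e≈p p~q (suc zero) = Adj-sym (¬Near⇒Adj-not ¬e≈q)
      where
      ¬e≈q : ¬ Near c e q
      ¬e≈q (inj₁ refl) = ¬e≈p (here (inj₂ (Adj-sym p~q)))
      ¬e≈q (inj₂ e~q)  = ¬e≈p (there (lose (∈-filter⁺ (Adj? c e) (∈-allFin q) e~q) (inj₂ (Adj-sym p~q))))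

    Blocks : Fin n × Fin n → Fin n → Set
    Blocks e p = Within2 (proj₁ e) p ⊎ Within2 (proj₂ e) p

    Blocks? : ∀ e → Decidable (Blocks e)
    Blocks? e p = Within2? (proj₁ e) p ⊎-dec Within2? (proj₂ e) p

    perEdge : ℕ
    perEdge = suc D * suc D + suc D * suc D

    count-Blocks : ∀ e → count (Blocks? e) (allFin n) ≤ perEdge
    count-Blocks e = ≤-trans (count-⊎ (Blocks? e) (Within2? (proj₁ e)) (Within2? (proj₂ e)) id (allFin n))
                             (+-mono-≤ (count-Within2 (proj₁ e)) (count-Within2 (proj₂ e)))

    ¬Blocks⇒Separated : ∀ {p q e} → Adj c p q → ¬ Blocks e p → Separated c (p , q) e
    ¬Blocks⇒Separated p~q ¬blocks i zero       = ¬Within2⇒Adj-not (¬blocks ∘ inj₁) p~q i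
    ¬Blocks⇒Separated p~q ¬blocks i (suc zero) = ¬Within2⇒Adj-not (¬blocks ∘ inj₂) p~q i

    extend-matching : ∀ {k} → InducedMatching c k → k * perEdge < count HasNeighbour? (allFin n) →
      InducedMatching c (suc k)
    extend-matching record { edges = es ; size = refl ; are-edges = es-edges ; separated = es-sep } room
      with p , has-neighbour , unblocked ← satisfied (count<count⇒Any HasNeighbour? (λ p → any? (λ e → Blocks? e p) es) (allFin n)
                                             (≤-<-trans (count-Any≤ Blocks? (allFin n) es
                                                          (All.tabulate λ {e} _ → count-Blocks e)) room))
      with q , p~q ← satisfied has-neighbour =
      record { edges     = (p , q) ∷ es
             ; size      = refl
             ; are-edges = p~q ∷ es-edges
             ; separated = All.map (¬Blocks⇒Separated p~q) (¬Any⇒All¬ es unblocked) ∷ es-sep }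

    matching-of-size : ∀ k → k * perEdge < count HasNeighbour? (allFin n) → InducedMatching c k
    matching-of-size zero    _    = record { edges = [] ; size = refl ; are-edges = [] ; separated = [] }
    matching-of-size (suc k) room = extend-matching (matching-of-size k room′) room′
      where
      room′ : k * perEdge < count HasNeighbour? (allFin n)
      room′ = ≤-<-trans (*-monoˡ-≤ perEdge (n≤1+n k)) room

    low-degree⇒matching : ∀ r → suc D * suc (r * perEdge) ≤ edgeCount χ c → InducedMatching c r
    low-degree⇒matching r many = matching-of-size r (*-cancelˡ-≤ (suc D) (≤-trans many edgeCount≤))

  clique⇒star : ∀ {c r t K} → Clique (not c) K → t * t < length K →
    edgeThreshold r t ≤ edgeCount χ c → ¬ HasInducedMono χ (matching r) → HasInducedMono χ (star t)
  clique⇒star {c} {r} {t} K-clique big many no-matching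
    with allFin? (λ v → degree c v <? ramseyBound t t)
  ... | yes low = contradiction (c , matching-copy (low-degree⇒matching c (<⇒≤ ∘ low) r many)) no-matching
  ... | no ¬low =
    let _ , high = ¬∀⟶∃¬ n _ (λ v → degree c v <? ramseyBound t t) ¬low
    in high-degree⇒star K-clique big (≮⇒≥ high)

  no-matching⇒star : ∀ {r t} → ramseyBound (suc (t * t)) (suc (t * t)) ≤ n →
    (∀ c → edgeThreshold r t ≤ edgeCount χ c) → ¬ HasInducedMono χ (matching r) → HasInducedMono χ (star t)
  no-matching⇒star {r} {t} big many no-matching
    with ramsey true (suc (t * t)) (suc (t * t)) (allFin⁺ n) (subst (_ ≤_) (sym (length-tabulate id)) big)
  ... | inj₁ (clique K _ |K|≡1+t² K-clique) =
    clique⇒star {false} {r} K-clique (≤-reflexive (sym |K|≡1+t²)) (many false) no-matching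
  ... | inj₂ (clique K _ |K|≡1+t² K-clique) =
    clique⇒star {true} {r} K-clique (≤-reflexive (sym |K|≡1+t²)) (many true) no-matching

theorem2p9 : (r t : ℕ) → 2 ≤ r → 2 ≤ t →
    Σ ℕ λ C → Σ ℕ λ N → (n : ℕ) → N ≤ n → (χ : Colouring n) →
      ((c : Bool) → C ≤ edgeCount χ c) →
      ¬ HasInducedMono χ (matching r) →
      HasInducedMono χ (star t)
theorem2p9 r t _ _ =
  edgeThreshold r t , ramseyBound (suc (t * t)) (suc (t * t)) , λ n big χ → no-matching⇒star χ {r} big
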